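{- The Diophantine equation $5^{x}-3^{x}=L_{r}$ in nonnegative integers $r,x$ has only the solution $(r,x)=(0,1)$.
   Context: $(L_n)_{n\ge0}$ is the Lucas sequence: $L_0=2$, $L_1=1$, $L_n=L_{n-1}+L_{n-2}$ for $n\ge 2$. -}

module Defs where

open import Data.Nat using (ℕ; zero; suc; _+_)

L : ℕ → ℕ
L zero = 2
L (suc zero) = 1
L (suc (suc n)) = L (suc n) + L n

module Submission where

-- Small x are handled by size: 5^0 ∸ 3^0 = 0 is never a Lucas number,
-- and 5^1 ∸ 3^1 = 2 = L r forces r = 0 since L 1 = 1 and L r ≥ 3 for r ≥ 2.
--
-- For x ≥ 2 the equation is refuted modulo M = 275 = 5² · 11.  The pair
-- (5^x mod M , 3^x mod M) evolves by a fixed map and, from x = 2 on,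
-- stays inside an explicit list of 20 states; likewise the pair
-- (L r mod M , L (r+1) mod M) stays inside an explicit list of 20 states.
-- Both facts follow from one general lemma: an orbit that starts in a
-- finite list closed under the step map never leaves it.  Finally a
-- finite decidable check shows that no power state is compatible with any
-- Lucas state, i.e. 5^x ≢ L r + 3^x (mod M) for all x ≥ 2 and all r.

open import Defs
open import Data.Nat using (ℕ; zero; suc; _+_; _*_; _^_; _∸_; _%_; _≤_; _≟_; s≤s; z≤n; NonZero)
open import Data.Nat.Properties using (+-comm; ^-monoˡ-≤; m∸n+n≡m; m≤m+n; ≤-trans)
open import Data.Nat.DivMod using (%-distribˡ-+; %-distribˡ-*; m%n%n≡m%n)
open import Data.Product using (_×_; _,_; proj₁; proj₂)
open import Data.Product.Properties using (≡-dec)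
open import Data.List using (List; []; _∷_)
open import Data.List.Relation.Unary.All as All using (All; all?)
open import Data.List.Membership.DecPropositional (≡-dec _≟_ _≟_) using (_∈_; _∈?_)
open import Relation.Binary.PropositionalEquality using (_≡_; refl; sym; trans; cong; cong₂; subst; module ≡-Reasoning)
open import Relation.Nullary using (¬_)
open import Relation.Nullary.Decidable using (toWitness; ¬?)
open import Data.Empty using (⊥-elim)

State : Set
State = ℕ × ℕ

Closed : (State → State) → List State → Set
Closed f S = All (λ s → f s ∈ S) S

orbit-stays : {f : State → State} {S : List State} (u : ℕ → State) →
              (∀ n → u (suc n) ≡ f (u n)) → Closed f S → u 0 ∈ S →
              ∀ n → u n ∈ S
orbit-stays u step closed start zero = start
orbit-stays {S = S} u step closed start (suc n) =
  subst (_∈ S) (sym (step n)) (All.lookup closed (orbit-stays u step closed start n))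

module Residues (m : ℕ) .{{_ : NonZero m}} where

  *-%-absorb : ∀ c p → (c * p) % m ≡ (c * (p % m)) % m
  *-%-absorb c p = begin
      (c * p) % m                 ≡⟨ %-distribˡ-* c p m ⟩
      ((c % m) * (p % m)) % m     ≡⟨ cong (λ z → ((c % m) * z) % m) (sym (m%n%n≡m%n p m)) ⟩
      ((c % m) * (p % m % m)) % m ≡⟨ sym (%-distribˡ-* c (p % m) m) ⟩
      (c * (p % m)) % m           ∎
    where open ≡-Reasoning

  powState : ℕ → State
  powState x = (5 ^ x % m , 3 ^ x % m)

  powStep : State → State
  powStep (a , b) = ((5 * a) % m , (3 * b) % m)

  powState-suc : ∀ x → powState (suc x) ≡ powStep (powState x)
  powState-suc x = cong₂ _,_ (*-%-absorb 5 (5 ^ x)) (*-%-absorb 3 (3 ^ x))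

  lucasState : ℕ → State
  lucasState r = (L r % m , L (suc r) % m)

  lucasStep : State → State
  lucasStep (a , b) = (b , (a + b) % m)

  lucasState-suc : ∀ r → lucasState (suc r) ≡ lucasStep (lucasState r)
  lucasState-suc r =
    cong (L (suc r) % m ,_)
         (trans (cong (_% m) (+-comm (L (suc r)) (L r))) (%-distribˡ-+ (L r) (L (suc r)) m))

  Compatible : State → State → Set
  Compatible (a , b) (c , d) = a ≡ (c + b) % m

  solution-compatible : ∀ x r → 5 ^ x ∸ 3 ^ x ≡ L r →
                        Compatible (powState x) (lucasState r)
  solution-compatible x r eq = begin
      5 ^ x % m                   ≡⟨ cong (_% m) five-pow ⟩
      (L r + 3 ^ x) % m           ≡⟨ %-distribˡ-+ (L r) (3 ^ x) m ⟩
      (L r % m + 3 ^ x % m) % m   ∎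
    where
    open ≡-Reasoning
    five-pow : 5 ^ x ≡ L r + 3 ^ x
    five-pow = trans (sym (m∸n+n≡m (^-monoˡ-≤ x (s≤s (s≤s (s≤s z≤n)))))) (cong (_+ 3 ^ x) eq)

-- The modulus 275 = 5² · 11, the smallest one refuting all x ≥ 2.
M : ℕ
M = 275

open Residues M

-- The orbit of (5^x mod M , 3^x mod M) for x ≥ 2: period 20, first entry 5^2 = 25.
powOrbit : List State
powOrbit = (25 , 9) ∷ (125 , 27) ∷ (75 , 81) ∷ (100 , 243) ∷ (225 , 179) ∷ (25 , 262) ∷ (125 , 236) ∷ (75 , 158) ∷ (100 , 199) ∷ (225 , 47) ∷ (25 , 141) ∷ (125 , 148) ∷ (75 , 169) ∷ (100 , 232) ∷ (225 , 146) ∷ (25 , 163) ∷ (125 , 214) ∷ (75 , 92) ∷ (100 , 1) ∷ (225 , 3) ∷ []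

lucasOrbit : List State
lucasOrbit = (2 , 1) ∷ (1 , 3) ∷ (3 , 4) ∷ (4 , 7) ∷ (7 , 11) ∷ (11 , 18) ∷ (18 , 29) ∷ (29 , 47) ∷ (47 , 76) ∷ (76 , 123) ∷ (123 , 199) ∷ (199 , 47) ∷ (47 , 246) ∷ (246 , 18) ∷ (18 , 264) ∷ (264 , 7) ∷ (7 , 271) ∷ (271 , 3) ∷ (3 , 274) ∷ (274 , 2) ∷ []

powState-in-orbit : ∀ k → powState (2 + k) ∈ powOrbit
powState-in-orbit =
  orbit-stays (λ k → powState (2 + k)) (λ k → powState-suc (2 + k))
              (toWitness {a? = all? (λ s → powStep s ∈? powOrbit) powOrbit} _)
              (toWitness {a? = powState 2 ∈? powOrbit} _)

lucasState-in-orbit : ∀ r → lucasState r ∈ lucasOrbit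
lucasState-in-orbit =
  orbit-stays lucasState lucasState-suc
              (toWitness {a? = all? (λ s → lucasStep s ∈? lucasOrbit) lucasOrbit} _)
              (toWitness {a? = lucasState 0 ∈? lucasOrbit} _)

orbits-incompatible : All (λ s → All (λ t → ¬ Compatible s t) lucasOrbit) powOrbit
orbits-incompatible =
  toWitness {a? = all? (λ s → all? (λ t → ¬? (proj₁ s ≟ (proj₁ t + proj₂ s) % M)) lucasOrbit) powOrbit} _

no-solution-x≥2 : ∀ k r → ¬ (5 ^ (2 + k) ∸ 3 ^ (2 + k) ≡ L r)
no-solution-x≥2 k r eq =
  All.lookup (All.lookup orbits-incompatible (powState-in-orbit k)) (lucasState-in-orbit r)
             (solution-compatible (2 + k) r eq)

L-positive : ∀ r → 1 ≤ L r
L-positive zero = s≤s z≤n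
L-positive (suc zero) = s≤s z≤n
L-positive (suc (suc r)) = ≤-trans (L-positive (suc r)) (m≤m+n _ _)

L-≥3 : ∀ r → 3 ≤ L (2 + r)
L-≥3 zero = s≤s (s≤s (s≤s z≤n))
L-≥3 (suc zero) = s≤s (s≤s (s≤s z≤n))
L-≥3 (suc (suc r)) = ≤-trans (L-≥3 (suc r)) (m≤m+n _ _)

L≡2⇒r≡0 : ∀ r → 2 ≡ L r → r ≡ 0
L≡2⇒r≡0 zero eq = refl
L≡2⇒r≡0 (suc zero) ()
L≡2⇒r≡0 (suc (suc r)) eq with subst (3 ≤_) (sym eq) (L-≥3 r)
... | s≤s (s≤s ())

corollary3 : (r x : ℕ) → (5 ^ x ∸ 3 ^ x ≡ L r → (r ≡ 0) × (x ≡ 1))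
                        × ((r ≡ 0) × (x ≡ 1) → 5 ^ x ∸ 3 ^ x ≡ L r)
corollary3 r x = only-solution r x , is-solution
  where
  is-solution : (r ≡ 0) × (x ≡ 1) → 5 ^ x ∸ 3 ^ x ≡ L r
  is-solution (refl , refl) = refl

  only-solution : ∀ r x → 5 ^ x ∸ 3 ^ x ≡ L r → (r ≡ 0) × (x ≡ 1)
  only-solution r zero eq with subst (1 ≤_) (sym eq) (L-positive r)
  ... | ()
  only-solution r (suc zero) eq = L≡2⇒r≡0 r eq , refl
  only-solution r (suc (suc k)) eq = ⊥-elim (no-solution-x≥2 k r eq)
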